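{- Let $C$ be a connected multi-complex. Then $P_C$ is a primitive element of $H_{\mathcal{C}}$, i.e. $\Delta(P_C)=P_C\otimes[\emptyset]+[\emptyset]\otimes P_C$.
   Context: A multiset based on a set $S$ is a function $S\to\{1,2,3,\dots\}$; $S$ is its support $\mathrm{supp}$. A multi-complex $C$ consists of a finite base set $n_C$, a finite family $\{A_i\}_{i\in I}$ of non-empty multisets (repetitions allowed) whose supports are subsets of $n_C$, and a partial order $\preceq$ on this family such that (1) for each $k\in n_C$ the singleton $\{k\}$ occurs exactly once among the $A_i$, and $\{k\}\preceq A_i$ iff $k$ belongs to $A_i$; (2) if $A_i\preceq A_j$ then $A_i$ is contained in $A_j$. The empty family is the unique multi-complex on $\emptyset$. Isomorphism: bijection of base sets inducing a bijection of families preserving and reflecting $\preceq$. A sub-multi-complex is a downward closed subfamily with inherited order; $D\preceq C$ means $D$ is a sub-multi-complex of $C$ with $n_D=n_C$. Disjoint union $C\sqcup D$: base $n_C\sqcup n_D$, disjoint union of families, induced order. Restriction $C|_X$ ($X\subseteq n_C$): based on $X$, consisting of the $A_i$ with $\mathrm{supp}(A_i)\subseteq X$. Elements $a,b\in n_C$ are path-connected if there are $a=a_0,a_1,\dots,a_l=b$ in $n_C$ and members $A_1,\dots,A_l$ with $\{a_{j-1},a_j\}\subseteq\mathrm{supp}(A_j)$; $C$ is connected if any two elements of $n_C$ are path-connected. $H_{\mathcal{C}}$ is the Hopf algebra over a field $k$ of characteristic $0$ with basis the isomorphism classes $[C]$, product $[C][D]=[C\sqcup D]$, unit $[\emptyset]$,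 coproduct $\Delta([C])=\sum_{X\sqcup Y=n_C}[C|_X]\otimes[C|_Y]$ (ordered pairs of disjoint subsets covering $n_C$), counit $\varepsilon([C])=1$ iff $n_C=\emptyset$, else $0$. For $C$, let $X_C=\{D:D\preceq C\}$ ordered by being a sub-multi-complex, with Möbius function $\mu_P$, and $P_C=\sum_{D\preceq C}\mu_P(D,C)[D]$ (sum over all such sub-multi-complexes). -}

module Defs where

open import Level using (Level; _⊔_) renaming (suc to lsuc)
open import Data.Nat as ℕ using (ℕ; zero; suc; _≤_; _≡ᵇ_)
open import Data.Integer as ℤ using (ℤ; +_; -[1+_]; 0ℤ; 1ℤ)
open import Data.Fin as Fin using (Fin; zero; suc)
open import Data.Bool using (Bool; true; false; _∧_; _∨_; not; if_then_else_)
open import Data.Vec as Vec using (Vec; []; _∷_; lookup)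
open import Data.List as List using (List; []; _∷_; _++_; map; concatMap; foldr)
open import Data.Bool.ListAction using (all; any)
open import Data.Product using (Σ; ∃; _×_; _,_)
open import Relation.Binary.PropositionalEquality using (_≡_; _≢_)
open import Relation.Nullary using (¬_)
open import Relation.Nullary.Decidable using (⌊_⌋)
open import Function.Bundles using (_↔_; Inverse)
open import Algebra.Bundles using (CommutativeRing)

-- Base set n_C = Fin n; the family {A_i}_{i ∈ I} is indexed by I = Fin m;
-- A i k = multiplicity of k in A_i (0 means k ∉ supp A_i);
-- le i j = true  iff  A_i ⪯ A_j.

record RawMC : Set where
  constructor mkRaw
  field
    n  : ℕ
    m  : ℕ
    A  : Fin m → Fin n → ℕ
    le : Fin m → Fin m → Bool

open RawMC public

single : ∀ {n} → Fin n → Fin n → ℕ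
single k x = if ⌊ k Fin.≟ x ⌋ then 1 else 0

record IsMC (C : RawMC) : Set where
  field
    nonempty        : ∀ i → ∃ λ k → A C i k ≢ 0
    le-refl         : ∀ i → le C i i ≡ true
    le-antisym      : ∀ i j → le C i j ≡ true → le C j i ≡ true → i ≡ j
    le-trans        : ∀ i j l → le C i j ≡ true → le C j l ≡ true → le C i l ≡ true
    singleton-exists : ∀ k → ∃ λ i → ∀ x → A C i x ≡ single k x
    singleton-unique : ∀ k i j → (∀ x → A C i x ≡ single k x) →
                       (∀ x → A C j x ≡ single k x) → i ≡ j
    singleton-below  : ∀ k i j → (∀ x → A C i x ≡ single k x) →
                       (le C i j ≡ true → A C j k ≢ 0) × (A C j k ≢ 0 → le C i j ≡ true)
    below-contained  : ∀ i j → le C i j ≡ true → ∀ k → A C i k ≤ A C j k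

record _≅_ (C D : RawMC) : Set where
  field
    base  : Fin (n C) ↔ Fin (n D)
    fam   : Fin (m C) ↔ Fin (m D)
    mult  : ∀ i k → A D (Inverse.to fam i) (Inverse.to base k) ≡ A C i k
    order : ∀ i j → le D (Inverse.to fam i) (Inverse.to fam j) ≡ le C i j

data Path (C : RawMC) : Fin (n C) → Fin (n C) → Set where
  here : ∀ {a} → Path C a a
  step : ∀ {a b} (c : Fin (n C)) (i : Fin (m C)) →
         A C i a ≢ 0 → A C i c ≢ 0 → Path C c b → Path C a b

Connected : RawMC → Set
Connected C = ∀ a b → Path C a b

count : ∀ {k} → Vec Bool k → ℕ
count []          = 0
count (true ∷ X)  = suc (count X)
count (false ∷ X) = count X

emb : ∀ {k} (X : Vec Bool k) → Fin (count X) → Fin k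
emb (true ∷ X) zero     = zero
emb (true ∷ X) (suc j)  = suc (emb X j)
emb (false ∷ X) j       = suc (emb X j)

full : (k : ℕ) → Vec Bool k
full k = Vec.replicate k true

compl : ∀ {k} → Vec Bool k → Vec Bool k
compl = Vec.map not

subB : ∀ {k} → Vec Bool k → Vec Bool k → Bool
subB []       []       = true
subB (x ∷ xs) (y ∷ ys) = (not x ∨ y) ∧ subB xs ys

eqB : ∀ {k} → Vec Bool k → Vec Bool k → Bool
eqB xs ys = subB xs ys ∧ subB ys xs

subsets : (k : ℕ) → List (Vec Bool k)
subsets zero    = [] ∷ []
subsets (suc k) = map (true ∷_) (subsets k) ++ map (false ∷_) (subsets k)

filterB : ∀ {a} {X : Set a} → (X → Bool) → List X → List X
filterB p []       = []
filterB p (x ∷ xs) = if p x then x ∷ filterB p xs else filterB p xs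

allFinL : (k : ℕ) → List (Fin k)
allFinL k = List.tabulate (λ i → i)

reindex : (C : RawMC) → Vec Bool (n C) → Vec Bool (m C) → RawMC
reindex C X Y = mkRaw (count X) (count Y)
  (λ j k → A C (emb Y j) (emb X k))
  (λ j j′ → le C (emb Y j) (emb Y j′))

suppIn : (C : RawMC) → Vec Bool (n C) → Fin (m C) → Bool
suppIn C X i = all (λ k → (A C i k ≡ᵇ 0) ∨ lookup X k) (allFinL (n C))

restrict : (C : RawMC) → Vec Bool (n C) → RawMC
restrict C X = reindex C X (Vec.tabulate (suppIn C X))

emptyMC : RawMC
emptyMC = mkRaw 0 0 (λ ()) (λ ())

-- A sub-multi-complex D with n_D = n_C is a
-- downward closed subfamily containing all singletons {k}, k ∈ n_C; it is
-- encoded by the subset S ⊆ I of indices of its members, and the order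
-- "is a sub-multi-complex of" becomes inclusion of index sets.

isSingletonB : (C : RawMC) → Fin (m C) → Bool
isSingletonB C i = any (λ k → all (λ x → A C i x ≡ᵇ single k x) (allFinL (n C))) (allFinL (n C))

isSubB : (C : RawMC) → Vec Bool (m C) → Bool
isSubB C S =
  all (λ i → not (isSingletonB C i) ∨ lookup S i) (allFinL (m C)) ∧
  all (λ i → all (λ j → not (le C j i ∧ lookup S i) ∨ lookup S j) (allFinL (m C))) (allFinL (m C))

XC : (C : RawMC) → List (Vec Bool (m C))
XC C = filterB (isSubB C) (subsets (m C))

subMC : (C : RawMC) → Vec Bool (m C) → RawMC
subMC C S = reindex C (full (n C)) S

sumℤ : List ℤ → ℤ
sumℤ = foldr ℤ._+_ 0ℤ

-- Möbius function of X_C, by the recursion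
--   μ(x,x) = 1,  μ(x,y) = - Σ_{x ⊆ z ⊊ y, z ∈ X_C} μ(x,z)  (x ⊊ y),  μ(x,y) = 0 otherwise,
-- computed with fuel; fuel suc (m C) is enough since strict chains in X_C
-- have length ≤ m C.
mobiusF : (C : RawMC) → ℕ → Vec Bool (m C) → Vec Bool (m C) → ℤ
mobiusF C zero    x y = 0ℤ
mobiusF C (suc f) x y =
  if eqB x y then 1ℤ
  else (if subB x y
        then ℤ.- sumℤ (map (mobiusF C f x)
                        (filterB (λ z → subB x z ∧ subB z y ∧ not (eqB z y)) (XC C)))
        else 0ℤ)

μP : (C : RawMC) → Vec Bool (m C) → Vec Bool (m C) → ℤ
μP C = mobiusF C (suc (m C))

-- Formal ℤ-linear combinations of (pairs of) multi-complexes;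
-- they denote elements of H_C (resp. H_C ⊗ H_C) via isomorphism classes.

Lin : Set
Lin = List (ℤ × RawMC)

Lin₂ : Set
Lin₂ = List (ℤ × RawMC × RawMC)

PC : RawMC → Lin
PC C = map (λ S → (μP C S (full (m C)) , subMC C S)) (XC C)

Δ₁ : RawMC → List (RawMC × RawMC)
Δ₁ D = map (λ X → (restrict D X , restrict D (compl X))) (subsets (n D))

Δ : Lin → Lin₂
Δ u = concatMap (λ { (c , D) → map (λ { (E , F) → (c , E , F) }) (Δ₁ D) }) u

_⊗_ : Lin → Lin → Lin₂
u ⊗ v = concatMap (λ { (c , D) → map (λ { (d , E) → (c ℤ.* d , D , E) }) v }) u

unitH : Lin
unitH = (1ℤ , emptyMC) ∷ []

module _ {c ℓ : Level} (R : CommutativeRing c ℓ) where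
  open CommutativeRing R
  natR : ℕ → Carrier
  natR zero    = 0#
  natR (suc k) = 1# + natR k

  intR : ℤ → Carrier
  intR (+ k)      = natR k
  intR -[1+ k ]   = - natR (suc k)

record Char0Field (c ℓ : Level) : Set (lsuc (c ⊔ ℓ)) where
  field
    cring    : CommutativeRing c ℓ
  open CommutativeRing cring
  field
    inverse : ∀ x → ¬ (x ≈ 0#) → ∃ λ y → (x * y) ≈ 1#
    char0   : ∀ k → ¬ (natR cring (suc k) ≈ 0#)

-- Equality in H_C ⊗ H_C over the field F: two formal combinations are equal
-- iff they pair equally with every function on pairs of isomorphism classes
-- (i.e. every isomorphism-invariant φ).
module _ {c ℓ : Level} (F : Char0Field c ℓ) where
  open Char0Field F
  open CommutativeRing cring

  Invariant₂ : (RawMC → RawMC → Carrier) → Set (ℓ)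
  Invariant₂ φ = ∀ {D D′ E E′} → D ≅ D′ → E ≅ E′ → φ D E ≈ φ D′ E′

  eval₂ : (RawMC → RawMC → Carrier) → Lin₂ → Carrier
  eval₂ φ = foldr (λ { (a , D , E) acc → (intR cring a * φ D E) + acc }) 0#

  EqH⊗H : Lin₂ → Lin₂ → Set (c ⊔ ℓ)
  EqH⊗H u v = (φ : RawMC → RawMC → Carrier) → Invariant₂ φ → eval₂ φ u ≈ eval₂ φ v

-- The sub-multi-complexes D ⪯ C form a lattice of order ideals of the family (those containing
-- all singletons), and a sign-reversing involution on each interval shows that μ(D, C) is
-- (-1)^|C ∖ D| when the members of C missing from D form an antichain, and 0 otherwise.
-- In Δ(P_C) = Σ_D μ(D, C) Σ_X [D|X] ⊗ [D|Xᶜ], the splittings X = n_C and X = ∅ give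
-- P_C ⊗ [∅] + [∅] ⊗ P_C.  For any other X, connectedness yields a member meeting both X and Xᶜ,
-- hence a maximal one mx, which is not a singleton and lies in neither D|X nor D|Xᶜ.  Toggling mx
-- in D preserves membership in X_C wherever μ(D, C) ≠ 0 (by maximality), leaves both restrictions
-- unchanged and flips the sign of μ(D, C), so the terms for X cancel in pairs.
module Submission where

open import Defs
open import Level using (Level)
open import Data.Nat using (_<_)
open import Data.List using (_++_)

open import Data.Nat as ℕ using (ℕ; zero; suc; _≡ᵇ_; s≤s)
import Data.Nat.Properties as ℕP
open import Data.Fin as Fin using (Fin; zero; suc)
import Data.Fin.Properties as FinP
open import Data.Bool as Bool using (Bool; true; false; _∧_; _∨_; not; if_then_else_; T)
import Data.Bool.Properties as BP
open import Data.Bool.ListAction using (all; any)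
open import Data.Vec as Vec using (Vec; []; _∷_; lookup; updateAt)
import Data.Vec.Properties as VP
open import Data.List as List using (List; []; _∷_; map; foldr)
open import Data.Integer as ℤ using (ℤ; 0ℤ; 1ℤ; +_; -[1+_])
import Data.Integer.Properties as ℤP
open import Data.Product using (Σ; ∃; _×_; _,_; proj₁; proj₂)
open import Data.Empty using (⊥; ⊥-elim)
open import Function using (id)
open import Function.Bundles using (_↔_; Inverse; mk↔ₛ′)
open import Function.Properties.Inverse using (↔-refl; ↔-sym; ↔-trans)
open import Relation.Binary.PropositionalEquality
open import Relation.Nullary using (yes; no; ¬?)
open import Relation.Nullary.Decidable using (⌊_⌋; _×-dec_)
open import Algebra.Bundles using (Ring; CommutativeRing)

true≢false-at : ∀ {b} → b ≡ true → b ≡ false → ⊥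
true≢false-at refl ()

≡-from-true⇔ : ∀ {a b : Bool} → (a ≡ true → b ≡ true) → (b ≡ true → a ≡ true) → a ≡ b
≡-from-true⇔ {false} {false} f g = refl
≡-from-true⇔ {false} {true}  f g = g refl
≡-from-true⇔ {true}  {false} f g = sym (f refl)
≡-from-true⇔ {true}  {true}  f g = refl

∧-elimˡ : ∀ {a b} → a ∧ b ≡ true → a ≡ true
∧-elimˡ = BP.∧-conicalˡ _ _

∧-elimʳ : ∀ {a b} → a ∧ b ≡ true → b ≡ true
∧-elimʳ = BP.∧-conicalʳ _ _

∧-intro : ∀ {a b} → a ≡ true → b ≡ true → a ∧ b ≡ true
∧-intro refl refl = refl

not∨-elim : ∀ {a b} → not a ∨ b ≡ true → a ≡ true → b ≡ true
not∨-elim e refl = e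

not∨-intro : ∀ {a b} → (a ≡ true → b ≡ true) → not a ∨ b ≡ true
not∨-intro {false} h = refl
not∨-intro {true}  h = h refl

≟-true⇒≡ : ∀ {k} {i j : Fin k} → ⌊ i Fin.≟ j ⌋ ≡ true → i ≡ j
≟-true⇒≡ {i = i} {j} h with i Fin.≟ j
... | yes i≡j = i≡j

≡⇒≟-true : ∀ {k} {i j : Fin k} → i ≡ j → ⌊ i Fin.≟ j ⌋ ≡ true
≡⇒≟-true {i = i} {j} i≡j with i Fin.≟ j
... | yes _ = refl
... | no i≢j = ⊥-elim (i≢j i≡j)

all-tabulate⁻ : ∀ {A : Set} {k} (p : A → Bool) (f : Fin k → A) →
                all p (List.tabulate f) ≡ true → ∀ i → p (f i) ≡ true
all-tabulate⁻ {k = suc k} p f h zero    = ∧-elimˡ h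
all-tabulate⁻ {k = suc k} p f h (suc i) = all-tabulate⁻ p (λ j → f (suc j)) (∧-elimʳ h) i

all-tabulate⁺ : ∀ {A : Set} {k} (p : A → Bool) (f : Fin k → A) →
                (∀ i → p (f i) ≡ true) → all p (List.tabulate f) ≡ true
all-tabulate⁺ {k = zero}  p f h = refl
all-tabulate⁺ {k = suc k} p f h = ∧-intro (h zero) (all-tabulate⁺ p (λ j → f (suc j)) (λ i → h (suc i)))

any-tabulate⁻ : ∀ {A : Set} {k} (p : A → Bool) (f : Fin k → A) →
                any p (List.tabulate f) ≡ true → ∃ λ i → p (f i) ≡ true
any-tabulate⁻ {k = suc k} p f h with p (f zero) in eq
... | true  = zero , eq
... | false with any-tabulate⁻ p (λ j → f (suc j)) h
...   | i , pi = suc i , pi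

all-allFin⁻ : ∀ {k} (p : Fin k → Bool) → all p (allFinL k) ≡ true → ∀ i → p i ≡ true
all-allFin⁻ p = all-tabulate⁻ p id

all-allFin⁺ : ∀ {k} (p : Fin k → Bool) → (∀ i → p i ≡ true) → all p (allFinL k) ≡ true
all-allFin⁺ p = all-tabulate⁺ p id

all-allFin-false : ∀ {k} (p : Fin k → Bool) i → p i ≡ false → all p (allFinL k) ≡ false
all-allFin-false p i pi = BP.¬-not λ h → true≢false-at (all-allFin⁻ p h i) pi

_⊆_ : ∀ {k} → Vec Bool k → Vec Bool k → Set
X ⊆ Y = ∀ i → lookup X i ≡ true → lookup Y i ≡ true

toggle : ∀ {k} → Fin k → Vec Bool k → Vec Bool k
toggle i X = updateAt X i not

lookup-toggle-≡ : ∀ {k} (i : Fin k) X → lookup (toggle i X) i ≡ not (lookup X i)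
lookup-toggle-≡ i X = VP.lookup∘updateAt i X

lookup-toggle-≢ : ∀ {k} (i j : Fin k) X → j ≢ i → lookup (toggle i X) j ≡ lookup X j
lookup-toggle-≢ i j X j≢i = VP.lookup∘updateAt′ j i j≢i X

module Insert {k} (z : Vec Bool k) (e : Fin k) (e∉z : lookup z e ≡ false) where

  z+e : Vec Bool k
  z+e = toggle e z

  e∈z+e : lookup z+e e ≡ true
  e∈z+e = trans (lookup-toggle-≡ e z) (cong not e∉z)

  z⊆z+e : z ⊆ z+e
  z⊆z+e w zw with w Fin.≟ e
  ... | yes refl = e∈z+e
  ... | no w≢e  = trans (lookup-toggle-≢ e w z w≢e) zw

  lookup-z+e-≢ : ∀ w → w ≢ e → lookup z+e w ≡ lookup z w
  lookup-z+e-≢ w = lookup-toggle-≢ e w z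

  z+e-∖e⊆z : ∀ w → w ≢ e → lookup z+e w ≡ true → lookup z w ≡ true
  z+e-∖e⊆z w w≢e h = trans (sym (lookup-z+e-≢ w w≢e)) h

lookup-ext : ∀ {A : Set} {k} (X Y : Vec A k) → (∀ i → lookup X i ≡ lookup Y i) → X ≡ Y
lookup-ext X Y h = trans (sym (VP.tabulate∘lookup X)) (trans (VP.tabulate-cong h) (VP.tabulate∘lookup Y))

lookup-full : ∀ k (i : Fin k) → lookup (full k) i ≡ true
lookup-full k i = VP.lookup-replicate i true

subB-sound : ∀ {k} (X Y : Vec Bool k) → subB X Y ≡ true → X ⊆ Y
subB-sound (true ∷ X) (true ∷ Y) h zero    _  = refl
subB-sound (a ∷ X)    (b ∷ Y)    h (suc i) Xi = subB-sound X Y (∧-elimʳ h) i Xi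

subB-complete : ∀ {k} (X Y : Vec Bool k) → X ⊆ Y → subB X Y ≡ true
subB-complete []          []      h = refl
subB-complete (false ∷ X) (b ∷ Y) h = subB-complete X Y (λ i → h (suc i))
subB-complete (true ∷ X)  (b ∷ Y) h rewrite h zero refl = subB-complete X Y (λ i → h (suc i))

eqB-sound : ∀ {k} (X Y : Vec Bool k) → eqB X Y ≡ true → X ≡ Y
eqB-sound X Y h = lookup-ext X Y λ i →
  ≡-from-true⇔ (subB-sound X Y (∧-elimˡ h) i) (subB-sound Y X (∧-elimʳ h) i)

eqB-complete : ∀ {k} (X Y : Vec Bool k) → X ≡ Y → eqB X Y ≡ true
eqB-complete X .X refl rewrite subB-complete X X (λ i h → h) = refl

⊊-witness : ∀ {k} (X Y : Vec Bool k) → X ⊆ Y → eqB X Y ≡ false →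
            ∃ λ j → lookup X j ≡ false × lookup Y j ≡ true
⊊-witness X Y X⊆Y X≠Y with FinP.any? (λ j → (lookup X j Bool.≟ false) ×-dec (lookup Y j Bool.≟ true))
... | yes (j , Xj , Yj) = j , Xj , Yj
... | no ¬witness = ⊥-elim (true≢false-at (eqB-complete X Y (lookup-ext X Y agree)) X≠Y)
  where
  agree : ∀ i → lookup X i ≡ lookup Y i
  agree i with lookup X i in Xi | lookup Y i in Yi
  ... | true  | true  = refl
  ... | false | false = refl
  ... | true  | false = ⊥-elim (true≢false-at (X⊆Y i Xi) Yi)
  ... | false | true  = ⊥-elim (¬witness (i , Xi , Yi))

count-mono : ∀ {k} (X Y : Vec Bool k) → X ⊆ Y → count X ℕ.≤ count Y
count-mono []          []          h = ℕ.z≤n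
count-mono (false ∷ X) (false ∷ Y) h = count-mono X Y (λ i → h (suc i))
count-mono (false ∷ X) (true ∷ Y)  h = ℕP.m≤n⇒m≤1+n (count-mono X Y (λ i → h (suc i)))
count-mono (true ∷ X)  (false ∷ Y) h with h zero refl
... | ()
count-mono (true ∷ X)  (true ∷ Y)  h = s≤s (count-mono X Y (λ i → h (suc i)))

count-strict-mono : ∀ {k} (X Y : Vec Bool k) → X ⊆ Y →
                    ∀ j → lookup X j ≡ false → lookup Y j ≡ true → count X ℕ.< count Y
count-strict-mono (false ∷ X) (true ∷ Y)  h zero    _  _  = s≤s (count-mono X Y (λ i → h (suc i)))
count-strict-mono (false ∷ X) (false ∷ Y) h (suc j) Xj Yj = count-strict-mono X Y (λ i → h (suc i)) j Xj Yj
count-strict-mono (false ∷ X) (true ∷ Y)  h (suc j) Xj Yj =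
  ℕP.m≤n⇒m≤1+n (count-strict-mono X Y (λ i → h (suc i)) j Xj Yj)
count-strict-mono (true ∷ X)  (false ∷ Y) h (suc j) Xj Yj with h zero refl
... | ()
count-strict-mono (true ∷ X)  (true ∷ Y)  h (suc j) Xj Yj = s≤s (count-strict-mono X Y (λ i → h (suc i)) j Xj Yj)

count-full : ∀ k → count (full k) ≡ k
count-full zero    = refl
count-full (suc k) = cong suc (count-full k)

count-empty : ∀ k → count (Vec.replicate k false) ≡ 0
count-empty zero    = refl
count-empty (suc k) = count-empty k

full≢empty : ∀ k → 0 < k → full k ≢ Vec.replicate k false
full≢empty (suc k) _ ()

module Sums {c ℓ} (R : Ring c ℓ) where
  open Ring R hiding (zero)
    renaming (refl to ≈-refl; sym to ≈-sym; trans to ≈-trans; reflexive to ≈-reflexive; setoid to ≈-setoid)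
  open import Algebra.Properties.Ring R using (-‿+-comm; -0#≈0#)
  open import Relation.Binary.Reasoning.Setoid ≈-setoid

  ∑ : {A : Set} → List A → (A → Carrier) → Carrier
  ∑ L f = foldr (λ a s → f a + s) 0# L

  ind : Bool → Carrier → Carrier
  ind b v = if b then v else 0#

  ∑-cong : ∀ {A : Set} (L : List A) {f g : A → Carrier} → (∀ a → f a ≈ g a) → ∑ L f ≈ ∑ L g
  ∑-cong []      h = ≈-refl
  ∑-cong (a ∷ L) h = +-cong (h a) (∑-cong L h)

  ∑-++ : ∀ {A : Set} (L M : List A) (f : A → Carrier) → ∑ (L ++ M) f ≈ ∑ L f + ∑ M f
  ∑-++ []      M f = ≈-sym (+-identityˡ _)
  ∑-++ (a ∷ L) M f = ≈-trans (+-congˡ (∑-++ L M f)) (≈-sym (+-assoc _ _ _))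

  ∑-map : ∀ {A B : Set} (L : List A) (g : A → B) (f : B → Carrier) → ∑ (map g L) f ≈ ∑ L (λ a → f (g a))
  ∑-map []      g f = ≈-refl
  ∑-map (a ∷ L) g f = +-congˡ (∑-map L g f)

  ∑-filter : ∀ {A : Set} (L : List A) (p : A → Bool) (f : A → Carrier) →
             ∑ (filterB p L) f ≈ ∑ L (λ a → ind (p a) (f a))
  ∑-filter []      p f = ≈-refl
  ∑-filter (a ∷ L) p f with p a
  ... | true  = +-congˡ (∑-filter L p f)
  ... | false = ≈-trans (∑-filter L p f) (≈-sym (+-identityˡ _))

  ∑-zero : ∀ {A : Set} (L : List A) (f : A → Carrier) → (∀ a → f a ≈ 0#) → ∑ L f ≈ 0#
  ∑-zero []      f h = ≈-refl
  ∑-zero (a ∷ L) f h = ≈-trans (+-cong (h a) (∑-zero L f h)) (+-identityˡ _)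

  ∑-+ : ∀ {A : Set} (L : List A) (f g : A → Carrier) → ∑ L (λ a → f a + g a) ≈ ∑ L f + ∑ L g
  ∑-+ []      f g = ≈-sym (+-identityˡ _)
  ∑-+ (a ∷ L) f g = begin
    (f a + g a) + ∑ L (λ a → f a + g a) ≈⟨ +-congˡ (∑-+ L f g) ⟩
    (f a + g a) + (∑ L f + ∑ L g)       ≈⟨ +-assoc _ _ _ ⟩
    f a + (g a + (∑ L f + ∑ L g))       ≈⟨ +-congˡ (≈-sym (+-assoc _ _ _)) ⟩
    f a + ((g a + ∑ L f) + ∑ L g)       ≈⟨ +-congˡ (+-congʳ (+-comm _ _)) ⟩
    f a + ((∑ L f + g a) + ∑ L g)       ≈⟨ +-congˡ (+-assoc _ _ _) ⟩
    f a + (∑ L f + (g a + ∑ L g))       ≈⟨ ≈-sym (+-assoc _ _ _) ⟩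
    (f a + ∑ L f) + (g a + ∑ L g)       ∎

  ∑-*ˡ : ∀ {A : Set} (L : List A) (k : Carrier) (f : A → Carrier) → ∑ L (λ a → k * f a) ≈ k * ∑ L f
  ∑-*ˡ []      k f = ≈-sym (zeroʳ k)
  ∑-*ˡ (a ∷ L) k f = ≈-trans (+-congˡ (∑-*ˡ L k f)) (≈-sym (distribˡ k _ _))

  ∑-neg : ∀ {A : Set} (L : List A) (f : A → Carrier) → ∑ L (λ a → - f a) ≈ - ∑ L f
  ∑-neg []      f = ≈-sym -0#≈0#
  ∑-neg (a ∷ L) f = ≈-trans (+-congˡ (∑-neg L f)) (-‿+-comm _ _)

  ∑-comm : ∀ {A B : Set} (L : List A) (M : List B) (f : A → B → Carrier) →
           ∑ L (λ a → ∑ M (f a)) ≈ ∑ M (λ b → ∑ L (λ a → f a b))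
  ∑-comm []      M f = ≈-sym (∑-zero M _ (λ _ → ≈-refl))
  ∑-comm (a ∷ L) M f = ≈-trans (+-congˡ (∑-comm L M f)) (≈-sym (∑-+ M (f a) _))

  ∑-subsets-suc : ∀ k (f : Vec Bool (suc k) → Carrier) →
                  ∑ (subsets (suc k)) f ≈ ∑ (subsets k) (λ X → f (true ∷ X)) + ∑ (subsets k) (λ X → f (false ∷ X))
  ∑-subsets-suc k f = ≈-trans (∑-++ (map (true ∷_) (subsets k)) _ f) (+-cong (∑-map (subsets k) _ f) (∑-map (subsets k) _ f))

  ∑-subsets-eqB : ∀ k (Y : Vec Bool k) (f : Vec Bool k → Carrier) →
                  ∑ (subsets k) (λ X → ind (eqB X Y) (f X)) ≈ f Y
  ∑-subsets-eqB zero    []        f = +-identityʳ _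
  ∑-subsets-eqB (suc k) (true ∷ Y) f = begin
    ∑ (subsets (suc k)) (λ X → ind (eqB X (true ∷ Y)) (f X)) ≈⟨ ∑-subsets-suc k _ ⟩
    ∑ (subsets k) (λ X → ind (eqB X Y) (f (true ∷ X))) + ∑ (subsets k) (λ X → ind (subB X Y ∧ false) (f (false ∷ X)))
      ≈⟨ +-cong (∑-subsets-eqB k Y _) (∑-zero (subsets k) _ λ X → ≈-reflexive (cong (λ b → ind b _) (BP.∧-zeroʳ (subB X Y)))) ⟩
    f (true ∷ Y) + 0#                                        ≈⟨ +-identityʳ _ ⟩
    f (true ∷ Y)                                             ∎
  ∑-subsets-eqB (suc k) (false ∷ Y) f = begin
    ∑ (subsets (suc k)) (λ X → ind (eqB X (false ∷ Y)) (f X)) ≈⟨ ∑-subsets-suc k _ ⟩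
    ∑ (subsets k) (λ X → 0#) + ∑ (subsets k) (λ X → ind (eqB X Y) (f (false ∷ X)))
      ≈⟨ +-cong (∑-zero (subsets k) _ (λ X → ≈-refl)) (∑-subsets-eqB k Y _) ⟩
    0# + f (false ∷ Y)                                        ≈⟨ +-identityˡ _ ⟩
    f (false ∷ Y)                                             ∎

  ∑-subsets-toggle-antisym : ∀ k (i : Fin k) (f : Vec Bool k → Carrier) →
    (∀ X → lookup X i ≡ false → f (toggle i X) ≈ - f X) → ∑ (subsets k) f ≈ 0#
  ∑-subsets-toggle-antisym (suc k) zero f anti = begin
    ∑ (subsets (suc k)) f                                                      ≈⟨ ∑-subsets-suc k f ⟩
    ∑ (subsets k) (λ X → f (true ∷ X)) + ∑ (subsets k) (λ X → f (false ∷ X))   ≈⟨ +-congʳ (∑-cong (subsets k) λ X → anti (false ∷ X) refl) ⟩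
    ∑ (subsets k) (λ X → - f (false ∷ X)) + ∑ (subsets k) (λ X → f (false ∷ X)) ≈⟨ +-congʳ (∑-neg (subsets k) _) ⟩
    - ∑ (subsets k) (λ X → f (false ∷ X)) + ∑ (subsets k) (λ X → f (false ∷ X)) ≈⟨ -‿inverseˡ _ ⟩
    0#                                                                         ∎
  ∑-subsets-toggle-antisym (suc k) (suc i) f anti = begin
    ∑ (subsets (suc k)) f                                                      ≈⟨ ∑-subsets-suc k f ⟩
    ∑ (subsets k) (λ X → f (true ∷ X)) + ∑ (subsets k) (λ X → f (false ∷ X))
      ≈⟨ +-cong (∑-subsets-toggle-antisym k i _ λ X → anti (true ∷ X))
                (∑-subsets-toggle-antisym k i _ λ X → anti (false ∷ X)) ⟩
    0# + 0#                                                                    ≈⟨ +-identityˡ 0# ⟩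
    0#                                                                         ∎

-- Minimal elements of a finite poset

module Minimal {k : ℕ} (R : Fin k → Fin k → Bool)
  (R-refl  : ∀ i → R i i ≡ true)
  (R-anti  : ∀ i j → R i j ≡ true → R j i ≡ true → i ≡ j)
  (R-trans : ∀ i j l → R i j ≡ true → R j l ≡ true → R i l ≡ true)
  (P : Fin k → Bool) where

  IsMinimal : Fin k → Set
  IsMinimal e = P e ≡ true × (∀ j → P j ≡ true → R j e ≡ true → j ≡ e)

  private
    below : Fin k → Vec Bool k
    below i = Vec.tabulate (λ l → P l ∧ R l i)

    lookup-below : ∀ i l → lookup (below i) l ≡ P l ∧ R l i
    lookup-below i l = VP.lookup∘tabulate _ l

    -- well-founded descent, measured by the number of P-elements below i
    descend : (b : ℕ) → ∀ i → P i ≡ true → count (below i) ℕ.< b → ∃ λ e → R e i ≡ true × IsMinimal e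
    descend (suc b) i Pi bound with FinP.any? (λ j → (P j Bool.≟ true) ×-dec ((R j i Bool.≟ true) ×-dec ¬? (j Fin.≟ i)))
    ... | no ¬lower = i , R-refl i , Pi , minimal
      where
      minimal : ∀ j → P j ≡ true → R j i ≡ true → j ≡ i
      minimal j Pj Rji with j Fin.≟ i
      ... | yes j≡i = j≡i
      ... | no j≢i  = ⊥-elim (¬lower (j , Pj , Rji , j≢i))
    ... | yes (j , Pj , Rji , j≢i) with descend b j Pj (ℕP.<-≤-trans fewer (ℕ.s≤s⁻¹ bound))
      where
      fewer : count (below j) ℕ.< count (below i)
      fewer = count-strict-mono (below j) (below i) included i i∉below-j i∈below-i
        where
        included : below j ⊆ below i
        included l h rewrite lookup-below j l | lookup-below i l =
          ∧-intro (∧-elimˡ h) (R-trans l j i (∧-elimʳ h) Rji)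
        i∉below-j : lookup (below j) i ≡ false
        i∉below-j rewrite lookup-below j i = BP.¬-not λ h → j≢i (sym (R-anti i j (∧-elimʳ h) Rji))
        i∈below-i : lookup (below i) i ≡ true
        i∈below-i rewrite lookup-below i i = ∧-intro Pi (R-refl i)
    ... | e , Rej , e-min = e , R-trans e j i Rej Rji , e-min

  minimal-below : ∀ i → P i ≡ true → ∃ λ e → R e i ≡ true × IsMinimal e
  minimal-below i Pi = descend (suc (count (below i))) i Pi ℕP.≤-refl

-- The Möbius function of X_C

module ℤ∑ = Sums ℤP.+-*-ring
import Algebra.Properties.AbelianGroup ℤP.+-0-abelianGroup as ℤ+

sumℤ-map : ∀ {A : Set} (L : List A) (g : A → ℤ) → sumℤ (map g L) ≡ ℤ∑.∑ L g
sumℤ-map []      g = refl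
sumℤ-map (a ∷ L) g = cong (λ t → g a ℤ.+ t) (sumℤ-map L g)

signDiff : ∀ {k} → Vec Bool k → Vec Bool k → ℤ
signDiff []      []      = 1ℤ
signDiff (a ∷ X) (b ∷ Y) = if b ∧ not a then ℤ.- signDiff X Y else signDiff X Y

signDiff-refl : ∀ {k} (X : Vec Bool k) → signDiff X X ≡ 1ℤ
signDiff-refl []          = refl
signDiff-refl (true ∷ X)  = signDiff-refl X
signDiff-refl (false ∷ X) = signDiff-refl X

signDiff-toggleʳ : ∀ {k} (e : Fin k) X Y → lookup X e ≡ false → signDiff X (toggle e Y) ≡ ℤ.- signDiff X Y
signDiff-toggleʳ zero    (false ∷ X) (true ∷ Y)  refl = sym (ℤP.neg-involutive _)
signDiff-toggleʳ zero    (false ∷ X) (false ∷ Y) refl = refl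
signDiff-toggleʳ (suc e) (a ∷ X)     (b ∷ Y)     h with b ∧ not a
... | true  = cong ℤ.-_ (signDiff-toggleʳ e X Y h)
... | false = signDiff-toggleʳ e X Y h

signDiff-toggleˡ : ∀ {k} (e : Fin k) X Y → lookup Y e ≡ true → signDiff (toggle e X) Y ≡ ℤ.- signDiff X Y
signDiff-toggleˡ zero    (true ∷ X)  (true ∷ Y) refl = refl
signDiff-toggleˡ zero    (false ∷ X) (true ∷ Y) refl = sym (ℤP.neg-involutive _)
signDiff-toggleˡ (suc e) (a ∷ X)     (b ∷ Y)    h with b ∧ not a
... | true  = cong ℤ.-_ (signDiff-toggleˡ e X Y h)
... | false = signDiff-toggleˡ e X Y h

if-neg : ∀ b (z : ℤ) → (if b then ℤ.- z else 0ℤ) ≡ ℤ.- (if b then z else 0ℤ)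
if-neg true  z = refl
if-neg false z = refl

module Möbius (C : RawMC) (isMC : IsMC C) where
  open IsMC isMC

  V : Set
  V = Vec Bool (m C)

  IsSub : V → Set
  IsSub S = (∀ i → isSingletonB C i ≡ true → lookup S i ≡ true) ×
            (∀ i j → le C j i ≡ true → lookup S i ≡ true → lookup S j ≡ true)

  isSubB-sound : ∀ S → isSubB C S ≡ true → IsSub S
  isSubB-sound S h =
    (λ i → not∨-elim (all-allFin⁻ _ (∧-elimˡ h) i)) ,
    (λ i j lji Si → not∨-elim (all-allFin⁻ _ (all-allFin⁻ _ (∧-elimʳ h) i) j) (∧-intro lji Si))

  isSubB-complete : ∀ S → IsSub S → isSubB C S ≡ true
  isSubB-complete S (singletons , down) =
    ∧-intro (all-allFin⁺ _ λ i → not∨-intro (singletons i))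
            (all-allFin⁺ _ λ i → all-allFin⁺ _ λ j → not∨-intro λ h → down i j (∧-elimˡ h) (∧-elimʳ h))

  full-isSub : IsSub (full (m C))
  full-isSub = (λ i _ → lookup-full _ i) , (λ i j _ _ → lookup-full _ j)

  diffB : V → V → Fin (m C) → Bool
  diffB x y i = lookup y i ∧ not (lookup x i)

  diffB-intro : ∀ x y i → lookup y i ≡ true → lookup x i ≡ false → diffB x y i ≡ true
  diffB-intro x y i yi xi rewrite yi | xi = refl

  diffB-elim : ∀ x y i → diffB x y i ≡ true → lookup y i ≡ true × lookup x i ≡ false
  diffB-elim x y i h = ∧-elimˡ h , BP.not-injective (∧-elimʳ h)

  DiffAntichain : V → V → Set
  DiffAntichain x y = ∀ i j → lookup y i ≡ true → lookup x i ≡ false →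
                              lookup y j ≡ true → lookup x j ≡ false → le C i j ≡ true → i ≡ j

  antichainB : V → V → Bool
  antichainB x y = all (λ i → all (λ j → not (diffB x y i ∧ diffB x y j ∧ le C i j) ∨ ⌊ i Fin.≟ j ⌋)
                                  (allFinL (m C)))
                       (allFinL (m C))

  antichainB-sound : ∀ x y → antichainB x y ≡ true → DiffAntichain x y
  antichainB-sound x y h i j yi xi yj xj lij = ≟-true⇒≡ (not∨-elim (all-allFin⁻ _ (all-allFin⁻ _ h i) j)
    (∧-intro (diffB-intro x y i yi xi) (∧-intro (diffB-intro x y j yj xj) lij)))

  antichainB-complete : ∀ x y → DiffAntichain x y → antichainB x y ≡ true
  antichainB-complete x y h = all-allFin⁺ _ λ i → all-allFin⁺ _ λ j → not∨-intro λ c →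
    let yi , xi = diffB-elim x y i (∧-elimˡ c)
        rest   = ∧-elimʳ {diffB x y i} c
        yj , xj = diffB-elim x y j (∧-elimˡ rest)
    in ≡⇒≟-true (h i j yi xi yj xj (∧-elimʳ {diffB x y j} rest))

  antichainB-cong : ∀ x y x′ y′ → (DiffAntichain x y → DiffAntichain x′ y′) →
                    (DiffAntichain x′ y′ → DiffAntichain x y) → antichainB x′ y′ ≡ antichainB x y
  antichainB-cong x y x′ y′ f g = ≡-from-true⇔
    (λ h → antichainB-complete x y (g (antichainB-sound x′ y′ h)))
    (λ h → antichainB-complete x′ y′ (f (antichainB-sound x y h)))

  μ-closed : V → V → ℤ
  μ-closed x y = if antichainB x y then signDiff x y else 0ℤ

  μ-closed-refl : ∀ x → μ-closed x x ≡ 1ℤ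
  μ-closed-refl x rewrite antichainB-complete x x (λ i j yi xi _ _ _ → ⊥-elim (true≢false-at yi xi)) =
    signDiff-refl x

  -- Toggling a minimal element e of y ∖ x is a sign-reversing involution on the interval [x, y] of X_C.
  module Interval (x y : V) (x-sub : IsSub x) (y-sub : IsSub y) (x⊆y : x ⊆ y)
    (e : Fin (m C)) (e∈y : lookup y e ≡ true) (e∉x : lookup x e ≡ false)
    (e-min : ∀ w → lookup y w ≡ true → lookup x w ≡ false → le C w e ≡ true → w ≡ e) where

    InInterval : V → Set
    InInterval z = IsSub z × x ⊆ z × z ⊆ y

    inIntervalB : V → Bool
    inIntervalB z = isSubB C z ∧ (subB x z ∧ subB z y)

    inIntervalB-sound : ∀ z → inIntervalB z ≡ true → InInterval z
    inIntervalB-sound z h =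
      isSubB-sound z (∧-elimˡ h) ,
      subB-sound x z (∧-elimˡ (∧-elimʳ {isSubB C z} h)) ,
      subB-sound z y (∧-elimʳ {subB x z} (∧-elimʳ {isSubB C z} h))

    inIntervalB-complete : ∀ z → InInterval z → inIntervalB z ≡ true
    inIntervalB-complete z (z-sub , x⊆z , z⊆y) =
      ∧-intro (isSubB-complete z z-sub) (∧-intro (subB-complete x z x⊆z) (subB-complete z y z⊆y))

    μ-on-interval : V → ℤ
    μ-on-interval z = if inIntervalB z then μ-closed x z else 0ℤ

    module _ (z : V) (e∉z : lookup z e ≡ false) where
      open Insert z e e∉z

      z+e-∈-interval : InInterval z → InInterval z+e
      z+e-∈-interval ((singletons , down) , x⊆z , z⊆y) =
        ((λ i si → z⊆z+e i (singletons i si)) , down′) , (λ w xw → z⊆z+e w (x⊆z w xw)) , z+e⊆y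
        where
        down′ : ∀ i j → le C j i ≡ true → lookup z+e i ≡ true → lookup z+e j ≡ true
        down′ i j lji zi with i Fin.≟ e
        ... | no i≢e = z⊆z+e j (down i j lji (z+e-∖e⊆z i i≢e zi))
        ... | yes refl with lookup x j in xj
        ...   | true  = z⊆z+e j (x⊆z j xj)
        ...   | false rewrite e-min j (proj₂ y-sub i j lji e∈y) xj lji = e∈z+e
        z+e⊆y : z+e ⊆ y
        z+e⊆y w zw with w Fin.≟ e
        ... | yes refl = e∈y
        ... | no w≢e  = z⊆y w (z+e-∖e⊆z w w≢e zw)

      z-∈-interval : InInterval z+e → DiffAntichain x z+e → InInterval z
      z-∈-interval ((singletons , down) , x⊆z+e , z+e⊆y) anti =
        (singletons′ , down′) , x⊆z , (λ w zw → z+e⊆y w (z⊆z+e w zw))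
        where
        singletons′ : ∀ i → isSingletonB C i ≡ true → lookup z i ≡ true
        singletons′ i si with i Fin.≟ e
        ... | yes refl = ⊥-elim (true≢false-at (proj₁ x-sub i si) e∉x)
        ... | no i≢e  = z+e-∖e⊆z i i≢e (singletons i si)
        down′ : ∀ i j → le C j i ≡ true → lookup z i ≡ true → lookup z j ≡ true
        down′ i j lji zi with i Fin.≟ e
        ... | yes refl = ⊥-elim (true≢false-at zi e∉z)
        ... | no i≢e with j Fin.≟ e
        ...   | no j≢e  = z+e-∖e⊆z j j≢e (down i j lji (z⊆z+e i zi))
        ...   | yes refl with lookup x i in xi
        ...     | true  = ⊥-elim (true≢false-at (proj₂ x-sub i j lji xi) e∉x)
        ...     | false = ⊥-elim (i≢e (sym (anti j i e∈z+e e∉x (z⊆z+e i zi) xi lji)))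
        x⊆z : x ⊆ z
        x⊆z w xw with w Fin.≟ e
        ... | yes refl = ⊥-elim (true≢false-at xw e∉x)
        ... | no w≢e  = z+e-∖e⊆z w w≢e (x⊆z+e w xw)

      antichainB-z+e : InInterval z → antichainB x z+e ≡ antichainB x z
      antichainB-z+e ((_ , down) , _ , z⊆y) = antichainB-cong x z x z+e forth back
        where
        forth : DiffAntichain x z → DiffAntichain x z+e
        forth anti i j zi xi zj xj lij with i Fin.≟ e | j Fin.≟ e
        ... | yes refl | yes refl = refl
        ... | yes refl | no j≢e  = ⊥-elim (true≢false-at (down j i lij (z+e-∖e⊆z j j≢e zj)) e∉z)
        ... | no i≢e  | yes refl = ⊥-elim (i≢e (e-min i (z⊆y i (z+e-∖e⊆z i i≢e zi)) xi lij))
        ... | no i≢e  | no j≢e  = anti i j (z+e-∖e⊆z i i≢e zi) xi (z+e-∖e⊆z j j≢e zj) xj lij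
        back : DiffAntichain x z+e → DiffAntichain x z
        back anti i j zi xi zj xj lij = anti i j (z⊆z+e i zi) xi (z⊆z+e j zj) xj lij

      μ-on-interval-toggle : μ-on-interval z+e ≡ ℤ.- μ-on-interval z
      μ-on-interval-toggle with inIntervalB z in z∈
      ... | true rewrite inIntervalB-complete z+e (z+e-∈-interval (inIntervalB-sound z z∈)) = begin
        μ-closed x z+e                                              ≡⟨ cong (λ b → if b then signDiff x z+e else 0ℤ)
                                                                          (antichainB-z+e (inIntervalB-sound z z∈)) ⟩
        (if antichainB x z then signDiff x z+e else 0ℤ)             ≡⟨ cong (λ t → if antichainB x z then t else 0ℤ)
                                                                          (signDiff-toggleʳ e x z e∉x) ⟩
        (if antichainB x z then ℤ.- signDiff x z else 0ℤ)           ≡⟨ if-neg (antichainB x z) _ ⟩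
        ℤ.- μ-closed x z                                            ∎
        where open ≡-Reasoning
      ... | false with inIntervalB z+e in z+e∈
      ...   | false = refl
      ...   | true with antichainB x z+e in anti
      ...     | false = refl
      ...     | true  = ⊥-elim (true≢false-at
                  (inIntervalB-complete z (z-∈-interval (inIntervalB-sound z+e z+e∈) (antichainB-sound x z+e anti))) z∈)

    ∑-μ-on-interval : ℤ∑.∑ (subsets (m C)) μ-on-interval ≡ 0ℤ
    ∑-μ-on-interval = ℤ∑.∑-subsets-toggle-antisym (m C) e μ-on-interval μ-on-interval-toggle

  mobiusF-closed : ∀ f x y → IsSub x → IsSub y → x ⊆ y → count y ℕ.< f ℕ.+ count x →
                   mobiusF C f x y ≡ μ-closed x y
  mobiusF-closed zero    x y _ _ x⊆y fuel = ⊥-elim (ℕP.<⇒≱ fuel (count-mono x y x⊆y))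
  mobiusF-closed (suc f) x y x-sub y-sub x⊆y fuel with eqB x y in x≟y
  ... | true with eqB-sound x y x≟y
  ...   | refl = sym (μ-closed-refl x)
  mobiusF-closed (suc f) x y x-sub y-sub x⊆y fuel | false = begin
      (if subB x y then ℤ.- sumℤ (map (mobiusF C f x) (filterB strictlyBelow (XC C))) else 0ℤ)
                                                                     ≡⟨ cong (if_then ℤ.- sumℤ (map (mobiusF C f x) (filterB strictlyBelow (XC C))) else 0ℤ)
                                                                             (subB-complete x y x⊆y) ⟩
      ℤ.- sumℤ (map (mobiusF C f x) (filterB strictlyBelow (XC C)))   ≡⟨ cong ℤ.-_ (sumℤ-map (filterB strictlyBelow (XC C)) (mobiusF C f x)) ⟩
      ℤ.- ℤ∑.∑ (filterB strictlyBelow (XC C)) (mobiusF C f x)         ≡⟨ cong ℤ.-_ ∑-strictly-below ⟩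
      ℤ.- ℤ.- μ-closed x y                                           ≡⟨ ℤP.neg-involutive _ ⟩
      μ-closed x y                                                   ∎
    where
    open ≡-Reasoning
    strictlyBelow : V → Bool
    strictlyBelow z = subB x z ∧ (subB z y ∧ not (eqB z y))

    witness = ⊊-witness x y x⊆y x≟y
    module M = Minimal (le C) le-refl le-antisym le-trans (diffB x y)
    minimal = M.minimal-below (proj₁ witness)
                (diffB-intro x y _ (proj₂ (proj₂ witness)) (proj₁ (proj₂ witness)))
    e = proj₁ minimal
    e∈y∖x = diffB-elim x y e (proj₁ (proj₂ (proj₂ minimal)))
    open Interval x y x-sub y-sub x⊆y e (proj₁ e∈y∖x) (proj₂ e∈y∖x)
           (λ w yw xw lwe → proj₂ (proj₂ (proj₂ minimal)) w (diffB-intro x y w yw xw) lwe)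

    below : V → ℤ
    below z = ℤ∑.ind (isSubB C z) (ℤ∑.ind (strictlyBelow z) (mobiusF C f x z))

    μ-on-interval-split : ∀ z → μ-on-interval z ≡ below z ℤ.+ ℤ∑.ind (eqB z y) (μ-closed x z)
    μ-on-interval-split z with eqB z y in z≟y
    ... | true with eqB-sound z y z≟y
    ...   | refl rewrite inIntervalB-complete z (y-sub , x⊆y , λ i h → h) | isSubB-complete z y-sub
                      | BP.∧-zeroʳ (subB z z) | BP.∧-zeroʳ (subB x z) = sym (ℤP.+-identityˡ _)
    μ-on-interval-split z | false with isSubB C z in z-sub | subB x z in x⊆z | subB z y in z⊆y
    ... | true  | true  | true  = trans (sym (mobiusF-closed f x z x-sub (isSubB-sound z z-sub) (subB-sound x z x⊆z) fewer))
                                        (sym (ℤP.+-identityʳ _))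
      where
      z⊊y = ⊊-witness z y (subB-sound z y z⊆y) (trans (cong (_∧ subB y z) z⊆y) z≟y)
      fewer : count z ℕ.< f ℕ.+ count x
      fewer = ℕP.<-≤-trans (count-strict-mono z y (subB-sound z y z⊆y) (proj₁ z⊊y) (proj₁ (proj₂ z⊊y)) (proj₂ (proj₂ z⊊y)))
                           (ℕ.s≤s⁻¹ fuel)
    ... | true  | true  | false = refl
    ... | true  | false | _     = refl
    ... | false | _     | _     = refl

    ∑-strictly-below : ℤ∑.∑ (filterB strictlyBelow (XC C)) (mobiusF C f x) ≡ ℤ.- μ-closed x y
    ∑-strictly-below = begin
      ℤ∑.∑ (filterB strictlyBelow (XC C)) (mobiusF C f x)     ≡⟨ ℤ∑.∑-filter (XC C) strictlyBelow _ ⟩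
      ℤ∑.∑ (XC C) (λ z → ℤ∑.ind (strictlyBelow z) _)           ≡⟨ ℤ∑.∑-filter (subsets (m C)) (isSubB C) _ ⟩
      ℤ∑.∑ (subsets (m C)) below                               ≡⟨ ℤ+.inverseˡ-unique _ _ ∑-interval ⟩
      ℤ.- μ-closed x y                                         ∎
      where
      ∑-interval : ℤ∑.∑ (subsets (m C)) below ℤ.+ μ-closed x y ≡ 0ℤ
      ∑-interval = begin
        ℤ∑.∑ (subsets (m C)) below ℤ.+ μ-closed x y
          ≡⟨ cong (λ t → ℤ∑.∑ (subsets (m C)) below ℤ.+ t) (sym (ℤ∑.∑-subsets-eqB (m C) y (μ-closed x))) ⟩
        ℤ∑.∑ (subsets (m C)) below ℤ.+ ℤ∑.∑ (subsets (m C)) (λ z → ℤ∑.ind (eqB z y) (μ-closed x z))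
          ≡⟨ sym (ℤ∑.∑-+ (subsets (m C)) below _) ⟩
        ℤ∑.∑ (subsets (m C)) (λ z → below z ℤ.+ ℤ∑.ind (eqB z y) (μ-closed x z))
          ≡⟨ sym (ℤ∑.∑-cong (subsets (m C)) μ-on-interval-split) ⟩
        ℤ∑.∑ (subsets (m C)) μ-on-interval
          ≡⟨ ∑-μ-on-interval ⟩
        0ℤ ∎

  μP-closed : ∀ S → IsSub S → μP C S (full (m C)) ≡ μ-closed S (full (m C))
  μP-closed S S-sub = mobiusF-closed (suc (m C)) S (full (m C)) S-sub full-isSub (λ i _ → lookup-full _ i)
    (s≤s (ℕP.≤-trans (ℕP.≤-reflexive (count-full (m C))) (ℕP.m≤m+n (m C) (count S))))

  module MaximalToggle (mx : Fin (m C)) (mx-max : ∀ j → le C mx j ≡ true → j ≡ mx)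
                       (mx-nonsingleton : isSingletonB C mx ≡ false) where

    fl : V
    fl = full (m C)

    μ-sub : V → ℤ
    μ-sub S = if isSubB C S then μ-closed S fl else 0ℤ

    module _ (S : V) (mx∉S : lookup S mx ≡ false) where
      open Insert S mx mx∉S renaming (z+e to S+mx; e∈z+e to mx∈S+mx; z⊆z+e to S⊆S+mx;
                                      lookup-z+e-≢ to lookup-S+mx-≢; z+e-∖e⊆z to S+mx-∖mx⊆S)

      isSub-remove : IsSub S+mx → IsSub S
      isSub-remove (singletons , down) = singletons′ , down′
        where
        singletons′ : ∀ i → isSingletonB C i ≡ true → lookup S i ≡ true
        singletons′ i si with i Fin.≟ mx
        ... | yes refl = ⊥-elim (true≢false-at si mx-nonsingleton)
        ... | no i≢mx = S+mx-∖mx⊆S i i≢mx (singletons i si)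
        down′ : ∀ i j → le C j i ≡ true → lookup S i ≡ true → lookup S j ≡ true
        down′ i j lji Si with i Fin.≟ mx
        ... | yes refl = ⊥-elim (true≢false-at Si mx∉S)
        ... | no i≢mx with j Fin.≟ mx
        ...   | yes refl = ⊥-elim (i≢mx (mx-max i lji))
        ...   | no j≢mx = S+mx-∖mx⊆S j j≢mx (down i j lji (S⊆S+mx i Si))

      isSub-add : IsSub S → DiffAntichain S fl → IsSub S+mx
      isSub-add (singletons , down) anti = (λ i si → S⊆S+mx i (singletons i si)) , down′
        where
        down′ : ∀ i j → le C j i ≡ true → lookup S+mx i ≡ true → lookup S+mx j ≡ true
        down′ i j lji Si with i Fin.≟ mx
        ... | no i≢mx = S⊆S+mx j (down i j lji (S+mx-∖mx⊆S i i≢mx Si))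
        ... | yes refl with j Fin.≟ mx
        ...   | yes refl = mx∈S+mx
        ...   | no j≢mx with lookup S j in Sj
        ...     | true  = S⊆S+mx j Sj
        ...     | false = ⊥-elim (j≢mx (anti j i (lookup-full _ j) Sj (lookup-full _ i) mx∉S lji))

      antichainB-add : IsSub S+mx → antichainB S+mx fl ≡ antichainB S fl
      antichainB-add (_ , down) = antichainB-cong S fl S+mx fl forth back
        where
        ∉S : ∀ i → lookup S+mx i ≡ false → lookup S i ≡ false
        ∉S i h = BP.¬-not λ Si → true≢false-at (S⊆S+mx i Si) h
        forth : DiffAntichain S fl → DiffAntichain S+mx fl
        forth anti i j fi Si fj Sj lij = anti i j fi (∉S i Si) fj (∉S j Sj) lij
        back : DiffAntichain S+mx fl → DiffAntichain S fl
        back anti i j fi Si fj Sj lij with i Fin.≟ mx | j Fin.≟ mx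
        ... | yes refl | _        = sym (mx-max j lij)
        ... | no i≢mx  | yes refl = ⊥-elim (true≢false-at (S+mx-∖mx⊆S i i≢mx (down j i lij mx∈S+mx)) Si)
        ... | no i≢mx  | no j≢mx  = anti i j fi (trans (lookup-S+mx-≢ i i≢mx) Si) fj (trans (lookup-S+mx-≢ j j≢mx) Sj) lij

      μ-sub-toggle : μ-sub S+mx ≡ ℤ.- μ-sub S
      μ-sub-toggle with isSubB C S in S-sub | isSubB C S+mx in S+mx-sub
      ... | false | false = refl
      ... | false | true  = ⊥-elim (true≢false-at (isSubB-complete S (isSub-remove (isSubB-sound S+mx S+mx-sub))) S-sub)
      ... | true  | false with antichainB S fl in anti
      ...   | false = refl
      ...   | true  = ⊥-elim (true≢false-at
                (isSubB-complete S+mx (isSub-add (isSubB-sound S S-sub) (antichainB-sound S fl anti))) S+mx-sub)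
      μ-sub-toggle | true | true = begin
        μ-closed S+mx fl                                     ≡⟨ cong (λ b → if b then signDiff S+mx fl else 0ℤ)
                                                                  (antichainB-add (isSubB-sound S+mx S+mx-sub)) ⟩
        (if antichainB S fl then signDiff S+mx fl else 0ℤ)   ≡⟨ cong (λ t → if antichainB S fl then t else 0ℤ)
                                                                  (signDiff-toggleˡ mx S fl (lookup-full _ mx)) ⟩
        (if antichainB S fl then ℤ.- signDiff S fl else 0ℤ)  ≡⟨ if-neg (antichainB S fl) _ ⟩
        ℤ.- μ-closed S fl                                    ∎
        where open ≡-Reasoning

-- Isomorphisms of restrictions

↔-suc : ∀ {a b} → Fin a ↔ Fin b → Fin (suc a) ↔ Fin (suc b)
↔-suc {a} {b} e = mk↔ₛ′ to from to∘from from∘to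
  where
  to : Fin (suc a) → Fin (suc b)
  to zero    = zero
  to (suc i) = suc (Inverse.to e i)
  from : Fin (suc b) → Fin (suc a)
  from zero    = zero
  from (suc i) = suc (Inverse.from e i)
  to∘from : ∀ j → to (from j) ≡ j
  to∘from zero    = refl
  to∘from (suc j) = cong suc (Inverse.strictlyInverseˡ e j)
  from∘to : ∀ i → from (to i) ≡ i
  from∘to zero    = refl
  from∘to (suc i) = cong suc (Inverse.strictlyInverseʳ e i)

↔-Fin0 : ∀ {a} → a ≡ 0 → Fin a ↔ Fin 0
↔-Fin0 refl = ↔-refl

≅-refl : ∀ {C} → C ≅ C
≅-refl = record { base = ↔-refl ; fam = ↔-refl ; mult = λ i k → refl ; order = λ i j → refl }

≅-sym : ∀ {C D} → C ≅ D → D ≅ C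
≅-sym {C} {D} C≅D = record { base = ↔-sym base ; fam = ↔-sym fam ; mult = mult′ ; order = order′ }
  where
  open _≅_ C≅D
  mult′ : ∀ i k → A C (Inverse.from fam i) (Inverse.from base k) ≡ A D i k
  mult′ i k = trans (sym (mult (Inverse.from fam i) (Inverse.from base k)))
                    (cong₂ (A D) (Inverse.strictlyInverseˡ fam i) (Inverse.strictlyInverseˡ base k))
  order′ : ∀ i j → le C (Inverse.from fam i) (Inverse.from fam j) ≡ le D i j
  order′ i j = trans (sym (order (Inverse.from fam i) (Inverse.from fam j)))
                     (cong₂ (le D) (Inverse.strictlyInverseˡ fam i) (Inverse.strictlyInverseˡ fam j))

≅-trans : ∀ {C D E} → C ≅ D → D ≅ E → C ≅ E
≅-trans C≅D D≅E = record
  { base  = ↔-trans (_≅_.base C≅D) (_≅_.base D≅E)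
  ; fam   = ↔-trans (_≅_.fam C≅D) (_≅_.fam D≅E)
  ; mult  = λ i k → trans (_≅_.mult D≅E _ _) (_≅_.mult C≅D i k)
  ; order = λ i j → trans (_≅_.order D≅E _ _) (_≅_.order C≅D i j)
  }

reindex-cong : ∀ C {X X′ Y Y′} → X ≡ X′ → Y ≡ Y′ → reindex C X Y ≅ reindex C X′ Y′
reindex-cong C refl refl = ≅-refl

restrict-cong : ∀ D {X X′} → X ≡ X′ → restrict D X ≅ restrict D X′
restrict-cong D refl = ≅-refl

reindex-empty≅ : ∀ C X Y → count X ≡ 0 → count Y ≡ 0 → reindex C X Y ≅ emptyMC
reindex-empty≅ C X Y X-empty Y-empty =
  record { base = ↔-Fin0 X-empty ; fam = ↔-Fin0 Y-empty ; mult = mult′ ; order = order′ }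
  where
  mult′ : ∀ i k → A emptyMC (Inverse.to (↔-Fin0 Y-empty) i) (Inverse.to (↔-Fin0 X-empty) k) ≡ A (reindex C X Y) i k
  mult′ i k with Inverse.to (↔-Fin0 Y-empty) i
  ... | ()
  order′ : ∀ i j → le emptyMC (Inverse.to (↔-Fin0 Y-empty) i) (Inverse.to (↔-Fin0 Y-empty) j) ≡ le (reindex C X Y) i j
  order′ i j with Inverse.to (↔-Fin0 Y-empty) i
  ... | ()

-- U ⊆ V read as a subset of k
compose : ∀ {k} (V : Vec Bool k) → Vec Bool (count V) → Vec Bool k
compose []         []      = []
compose (true ∷ V)  (u ∷ U) = u ∷ compose V U
compose (false ∷ V) U       = false ∷ compose V U

compose-↔ : ∀ {k} (V : Vec Bool k) (U : Vec Bool (count V)) →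
  Σ (Fin (count U) ↔ Fin (count (compose V U))) λ e → ∀ j → emb (compose V U) (Inverse.to e j) ≡ emb V (emb U j)
compose-↔ []          []         = ↔-refl , λ ()
compose-↔ (true ∷ V)  (true ∷ U) with compose-↔ V U
... | e , commutes = ↔-suc e , λ { zero → refl ; (suc j) → cong suc (commutes j) }
compose-↔ (true ∷ V)  (false ∷ U) with compose-↔ V U
... | e , commutes = e , λ j → cong suc (commutes j)
compose-↔ (false ∷ V) U with compose-↔ V U
... | e , commutes = e , λ j → cong suc (commutes j)

_∧ᵛ_ : ∀ {k} → Vec Bool k → Vec Bool k → Vec Bool k
_∧ᵛ_ = Vec.zipWith _∧_

compose-tabulate : ∀ {k} (V : Vec Bool k) (Q : Fin k → Bool) →
                   compose V (Vec.tabulate (λ j → Q (emb V j))) ≡ V ∧ᵛ Vec.tabulate Q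
compose-tabulate []          Q = refl
compose-tabulate (true ∷ V)  Q = cong (Q zero ∷_) (compose-tabulate V (λ i → Q (suc i)))
compose-tabulate (false ∷ V) Q = cong (false ∷_) (compose-tabulate V (λ i → Q (suc i)))

∧ᵛ-toggle : ∀ {k} (i : Fin k) (S Q : Vec Bool k) → lookup Q i ≡ false → toggle i S ∧ᵛ Q ≡ S ∧ᵛ Q
∧ᵛ-toggle zero    (s ∷ S) (false ∷ Q) refl = cong (_∷ S ∧ᵛ Q) (trans (BP.∧-zeroʳ _) (sym (BP.∧-zeroʳ _)))
∧ᵛ-toggle (suc i) (s ∷ S) (q ∷ Q)     h    = cong (s ∧ q ∷_) (∧ᵛ-toggle i S Q h)

∧ᵛ-identityʳ : ∀ {k} (S Q : Vec Bool k) → (∀ i → lookup Q i ≡ true) → S ∧ᵛ Q ≡ S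
∧ᵛ-identityʳ []      []      h = refl
∧ᵛ-identityʳ (s ∷ S) (q ∷ Q) h rewrite h zero = cong₂ _∷_ (BP.∧-identityʳ s) (∧ᵛ-identityʳ S Q (λ i → h (suc i)))

∧ᵛ-zeroʳ : ∀ {k} (S Q : Vec Bool k) → (∀ i → lookup Q i ≡ false) → S ∧ᵛ Q ≡ Vec.replicate k false
∧ᵛ-zeroʳ []      []      h = refl
∧ᵛ-zeroʳ (s ∷ S) (q ∷ Q) h rewrite h zero = cong₂ _∷_ (BP.∧-zeroʳ s) (∧ᵛ-zeroʳ S Q (λ i → h (suc i)))

compose-full : ∀ k → compose (full k) (full (count (full k))) ≡ full k
compose-full zero    = refl
compose-full (suc k) = cong (true ∷_) (compose-full k)

compose-empty : ∀ k → compose (full k) (Vec.replicate (count (full k)) false) ≡ Vec.replicate k false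
compose-empty zero    = refl
compose-empty (suc k) = cong (false ∷_) (compose-empty k)

compl-full : ∀ k → compl (full k) ≡ Vec.replicate k false
compl-full zero    = refl
compl-full (suc k) = cong (false ∷_) (compl-full k)

compl-empty : ∀ k → compl (Vec.replicate k false) ≡ full k
compl-empty zero    = refl
compl-empty (suc k) = cong (true ∷_) (compl-empty k)

unfull : ∀ {k} → Fin k → Fin (count (full k))
unfull {suc k} zero    = zero
unfull {suc k} (suc x) = suc (unfull x)

emb-unfull : ∀ {k} (x : Fin k) → emb (full k) (unfull x) ≡ x
emb-unfull {suc k} zero    = refl
emb-unfull {suc k} (suc x) = cong suc (emb-unfull x)

unfull-emb : ∀ {k} (j : Fin (count (full k))) → unfull (emb (full k) j) ≡ j
unfull-emb {suc k} zero    = refl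
unfull-emb {suc k} (suc j) = cong suc (unfull-emb j)

restrict-subMC≅ : ∀ C S X → restrict (subMC C S) X ≅
  reindex C (compose (full (n C)) X) (compose S (Vec.tabulate (suppIn (subMC C S) X)))
restrict-subMC≅ C S X = record
  { base  = proj₁ onBase
  ; fam   = proj₁ onFamily
  ; mult  = λ i k → cong₂ (A C) (proj₂ onFamily i) (proj₂ onBase k)
  ; order = λ i j → cong₂ (le C) (proj₂ onFamily i) (proj₂ onFamily j)
  }
  where
  onBase   = compose-↔ (full (n C)) X
  onFamily = compose-↔ S (Vec.tabulate (suppIn (subMC C S) X))

single-≢0⇒≡ : ∀ {k} (a x : Fin k) → single a x ≢ 0 → a ≡ x
single-≢0⇒≡ a x h with a Fin.≟ x
... | yes a≡x = a≡x
... | no _    = ⊥-elim (h refl)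

≡ᵇ0-false : ∀ a → a ≢ 0 → (a ≡ᵇ 0) ≡ false
≡ᵇ0-false zero    h = ⊥-elim (h refl)
≡ᵇ0-false (suc a) h = refl

module Restrictions (C : RawMC) (isMC : IsMC C) where
  open IsMC isMC

  N : ℕ
  N = count (full (n C))

  -- supp A_i ⊆ X, for X ⊆ n_C seen as a subset of the base of a sub-multi-complex
  suppWithin : Vec Bool N → Fin (m C) → Bool
  suppWithin X i = all (λ k → (A C i (emb (full (n C)) k) ≡ᵇ 0) ∨ lookup X k) (allFinL N)

  suppWithin-false : ∀ X i k → A C i (emb (full (n C)) k) ≢ 0 → lookup X k ≡ false → suppWithin X i ≡ false
  suppWithin-false X i k A≢0 k∉X = all-allFin-false _ k (cong₂ _∨_ (≡ᵇ0-false _ A≢0) k∉X)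

  restrict-subMC≅reindex : ∀ X S →
    restrict (subMC C S) X ≅ reindex C (compose (full (n C)) X) (S ∧ᵛ Vec.tabulate (suppWithin X))
  restrict-subMC≅reindex X S = ≅-trans (restrict-subMC≅ C S X) (reindex-cong C refl (compose-tabulate S (suppWithin X)))

  restrict-subMC-toggle : ∀ X S i → suppWithin X i ≡ false →
                          restrict (subMC C S) X ≅ restrict (subMC C (toggle i S)) X
  restrict-subMC-toggle X S i i⊈X = ≅-trans (restrict-subMC≅reindex X S) (≅-trans
    (reindex-cong C refl (sym (∧ᵛ-toggle i S _ (trans (VP.lookup∘tabulate _ i) i⊈X))))
    (≅-sym (restrict-subMC≅reindex X (toggle i S))))

  restrict-subMC-full : ∀ S → restrict (subMC C S) (full N) ≅ subMC C S
  restrict-subMC-full S = ≅-trans (restrict-subMC≅reindex (full N) S)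
    (reindex-cong C (compose-full (n C)) (∧ᵛ-identityʳ S _ λ i → trans (VP.lookup∘tabulate _ i)
      (all-allFin⁺ _ λ k → trans (cong ((A C i (emb (full (n C)) k) ≡ᵇ 0) ∨_) (lookup-full N k)) (BP.∨-zeroʳ _))))

  restrict-subMC-empty : ∀ S → restrict (subMC C S) (Vec.replicate N false) ≅ emptyMC
  restrict-subMC-empty S = ≅-trans (restrict-subMC≅reindex (Vec.replicate N false) S) (≅-trans
    (reindex-cong C (compose-empty (n C)) (∧ᵛ-zeroʳ S _ λ i → trans (VP.lookup∘tabulate _ i) (nonempty-⊈∅ i)))
    (reindex-empty≅ C _ _ (count-empty (n C)) (count-empty (m C))))
    where
    nonempty-⊈∅ : ∀ i → suppWithin (Vec.replicate N false) i ≡ false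
    nonempty-⊈∅ i with nonempty i
    ... | x , A≢0 = suppWithin-false (Vec.replicate N false) i (unfull x) (λ e → A≢0 (trans (cong (A C i) (sym (emb-unfull x))) e))
                                     (VP.lookup-replicate (unfull x) false)

  module Crossing (X : Vec Bool N) where
    inX : Fin (n C) → Bool
    inX x = lookup X (unfull x)

    path-crosses : ∀ {a b} → Path C a b → inX a ≡ true → inX b ≡ false →
      ∃ λ i → ∃ λ p → ∃ λ q → A C i p ≢ 0 × A C i q ≢ 0 × inX p ≡ true × inX q ≡ false
    path-crosses here a∈ b∉ = ⊥-elim (true≢false-at a∈ b∉)
    path-crosses {a} (step c i Aia≢0 Aic≢0 rest) a∈ b∉ with inX c in c∈
    ... | false = i , a , c , Aia≢0 , Aic≢0 , a∈ , c∈
    ... | true  = path-crosses rest c∈ b∉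

    module Max = Minimal (λ a b → le C b a) le-refl (λ i j r s → le-antisym i j s r) (λ a b c r s → le-trans c b a s r)

    -- Members only grow going up, so a maximal member above a crossing one still crosses X.
    maximal-crossing : ∀ k₁ k₀ → lookup X k₁ ≡ true → lookup X k₀ ≡ false → Connected C →
      ∃ λ mx → (∀ j → le C mx j ≡ true → j ≡ mx) × isSingletonB C mx ≡ false ×
               suppWithin X mx ≡ false × suppWithin (compl X) mx ≡ false
    maximal-crossing k₁ k₀ k₁∈X k₀∉X connected
      with path-crosses (connected (emb (full (n C)) k₁) (emb (full (n C)) k₀))
             (trans (cong (lookup X) (unfull-emb k₁)) k₁∈X) (trans (cong (lookup X) (unfull-emb k₀)) k₀∉X)
    ... | i , p , q , Aip≢0 , Aiq≢0 , p∈X , q∉X = mx , mx-max , mx-nonsingleton , mx⊈X , mx⊈Xᶜ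
      where
      maximal = Max.minimal-below (le C i) i (le-refl i)
      mx = proj₁ maximal
      i≤mx : le C i mx ≡ true
      i≤mx = proj₁ (proj₂ maximal)
      mx-max : ∀ j → le C mx j ≡ true → j ≡ mx
      mx-max j mx≤j = proj₂ (proj₂ (proj₂ maximal)) j (le-trans i mx j i≤mx mx≤j) mx≤j
      ≢0-up : ∀ x → A C i x ≢ 0 → A C mx x ≢ 0
      ≢0-up x Aix≢0 e = Aix≢0 (ℕP.n≤0⇒n≡0 (subst (A C i x ℕ.≤_) e (below-contained i mx i≤mx x)))
      mx-nonsingleton : isSingletonB C mx ≡ false
      mx-nonsingleton = BP.¬-not λ h →
        let k , mx-is-k = any-tabulate⁻ _ id h
            eqs : ∀ x → A C mx x ≡ single k x
            eqs x = ℕP.≡ᵇ⇒≡ _ _ (subst T (sym (all-allFin⁻ _ mx-is-k x)) _)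
            k≡p = single-≢0⇒≡ k p (λ e → ≢0-up p Aip≢0 (trans (eqs p) e))
            k≡q = single-≢0⇒≡ k q (λ e → ≢0-up q Aiq≢0 (trans (eqs q) e))
        in true≢false-at p∈X (trans (cong inX (trans (sym k≡p) k≡q)) q∉X)
      mx⊈X : suppWithin X mx ≡ false
      mx⊈X = suppWithin-false X mx (unfull q) (λ e → ≢0-up q Aiq≢0 (trans (cong (A C mx) (sym (emb-unfull q))) e)) q∉X
      mx⊈Xᶜ : suppWithin (compl X) mx ≡ false
      mx⊈Xᶜ = suppWithin-false (compl X) mx (unfull p) (λ e → ≢0-up p Aip≢0 (trans (cong (A C mx) (sym (emb-unfull p))) e))
                (trans (VP.lookup-map (unfull p) not X) (cong not p∈X))

-- Evaluating coproducts against an invariant pairing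

intR-neg : ∀ {c ℓ} (R : CommutativeRing c ℓ) z →
           CommutativeRing._≈_ R (intR R (ℤ.- z)) (CommutativeRing.-_ R (intR R z))
intR-neg R (+ zero)  = CommutativeRing.sym R (-0#≈0#)
  where open import Algebra.Properties.Ring (CommutativeRing.ring R) using (-0#≈0#)
intR-neg R (+ suc k) = CommutativeRing.refl R
intR-neg R -[1+ k ]  = CommutativeRing.sym R (-‿involutive _)
  where open import Algebra.Properties.Ring (CommutativeRing.ring R) using (-‿involutive)

module Evaluation {c ℓ} (F : Char0Field c ℓ) (φ : RawMC → RawMC → CommutativeRing.Carrier (Char0Field.cring F)) where
  open Char0Field F
  open CommutativeRing cring hiding (zero)
    renaming (refl to ≈-refl; sym to ≈-sym; trans to ≈-trans; reflexive to ≈-reflexive; setoid to ≈-setoid)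
  open Sums ring using (∑; ∑-cong; ∑-*ˡ)
  open import Relation.Binary.Reasoning.Setoid ≈-setoid

  eval : Lin₂ → Carrier
  eval = eval₂ F φ

  eval-++ : ∀ u v → eval (u ++ v) ≈ eval u + eval v
  eval-++ []      v = ≈-sym (+-identityˡ _)
  eval-++ (t ∷ u) v = ≈-trans (+-congˡ (eval-++ u v)) (≈-sym (+-assoc _ _ _))

  eval-map : ∀ {X : Set} (L : List X) (h : X → ℤ × RawMC × RawMC) →
    eval (map h L) ≈ ∑ L (λ x → intR cring (proj₁ (h x)) * φ (proj₁ (proj₂ (h x))) (proj₂ (proj₂ (h x))))
  eval-map []      h = ≈-refl
  eval-map (x ∷ L) h = +-congˡ (eval-map L h)

  eval-Δ : ∀ u → eval (Δ u) ≈ ∑ u (λ (a , D) → intR cring a * ∑ (Δ₁ D) (λ (E , G) → φ E G))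
  eval-Δ []            = ≈-refl
  eval-Δ ((a , D) ∷ u) = begin
    eval (map (λ (E , G) → (a , E , G)) (Δ₁ D) ++ Δ u)            ≈⟨ eval-++ (map (λ (E , G) → (a , E , G)) (Δ₁ D)) (Δ u) ⟩
    eval (map (λ (E , G) → (a , E , G)) (Δ₁ D)) + eval (Δ u)
      ≈⟨ +-cong (≈-trans (eval-map (Δ₁ D) _) (∑-*ˡ (Δ₁ D) (intR cring a) _)) (eval-Δ u) ⟩
    intR cring a * ∑ (Δ₁ D) (λ (E , G) → φ E G) + ∑ u (λ (a , D) → intR cring a * ∑ (Δ₁ D) (λ (E , G) → φ E G)) ∎

  eval-⊗unit : ∀ u → eval (u ⊗ unitH) ≈ ∑ u (λ (a , D) → intR cring a * φ D emptyMC)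
  eval-⊗unit []            = ≈-refl
  eval-⊗unit ((a , D) ∷ u) = +-cong (*-congʳ (≈-reflexive (cong (intR cring) (ℤP.*-identityʳ a)))) (eval-⊗unit u)

  eval-unit⊗ : ∀ u → eval (unitH ⊗ u) ≈ ∑ u (λ (a , D) → intR cring a * φ emptyMC D)
  eval-unit⊗ u = begin
    eval (map (λ (d , E) → (1ℤ ℤ.* d , emptyMC , E)) u ++ [])   ≈⟨ eval-++ (map (λ (d , E) → (1ℤ ℤ.* d , emptyMC , E)) u) [] ⟩
    eval (map (λ (d , E) → (1ℤ ℤ.* d , emptyMC , E)) u) + 0#    ≈⟨ +-identityʳ _ ⟩
    eval (map (λ (d , E) → (1ℤ ℤ.* d , emptyMC , E)) u)         ≈⟨ eval-map u _ ⟩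
    ∑ u (λ (d , E) → intR cring (1ℤ ℤ.* d) * φ emptyMC E)
      ≈⟨ ∑-cong u (λ (d , E) → *-congʳ (≈-reflexive (cong (intR cring) (ℤP.*-identityˡ d)))) ⟩
    ∑ u (λ (a , D) → intR cring a * φ emptyMC D)                ∎

-- Primitivity of P_C

module Primitivity {c ℓ} (F : Char0Field c ℓ) (C : RawMC) (isMC : IsMC C) (connected : Connected C) (pos : 0 < n C)
  (φ : RawMC → RawMC → CommutativeRing.Carrier (Char0Field.cring F)) (φ-inv : Invariant₂ F φ) where
  open Char0Field F
  open CommutativeRing cring hiding (zero)
    renaming (refl to ≈-refl; sym to ≈-sym; trans to ≈-trans; reflexive to ≈-reflexive; setoid to ≈-setoid)
  open import Algebra.Properties.Ring ring using (-‿distribˡ-*)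
  open Sums ring
  open Evaluation F φ
  open import Relation.Binary.Reasoning.Setoid ≈-setoid
  open Möbius C isMC
  open Restrictions C isMC

  coeff : V → Carrier
  coeff S = intR cring (μP C S (full (m C)))

  term : Vec Bool N → V → Carrier
  term X S = φ (restrict (subMC C S) X) (restrict (subMC C S) (compl X))

  proper : Vec Bool N → Bool
  proper X = not (eqB X (full N)) ∧ not (eqB X (Vec.replicate N false))

  term-split : ∀ S X → term X S ≈
    (ind (eqB X (full N)) (term X S) + ind (eqB X (Vec.replicate N false)) (term X S)) + ind (proper X) (term X S)
  term-split S X with eqB X (full N) in X-full | eqB X (Vec.replicate N false) in X-empty
  ... | true  | true  = ⊥-elim (full≢empty N (subst (0 <_) (sym (count-full (n C))) pos)
                                 (trans (sym (eqB-sound X _ X-full)) (eqB-sound X _ X-empty)))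
  ... | true  | false = ≈-sym (≈-trans (+-identityʳ _) (+-identityʳ _))
  ... | false | true  = ≈-sym (≈-trans (+-identityʳ _) (+-identityˡ _))
  ... | false | false = ≈-sym (≈-trans (+-congʳ (+-identityʳ _)) (+-identityˡ _))

  ∑-term : ∀ S → ∑ (subsets N) (λ X → term X S) ≈
    (φ (subMC C S) emptyMC + φ emptyMC (subMC C S)) + ∑ (subsets N) (λ X → ind (proper X) (term X S))
  ∑-term S = begin
    ∑ (subsets N) (λ X → term X S)                                                   ≈⟨ ∑-cong (subsets N) (term-split S) ⟩
    ∑ (subsets N) (λ X → (ind (eqB X (full N)) (term X S) + ind (eqB X (Vec.replicate N false)) (term X S))
                         + ind (proper X) (term X S))
      ≈⟨ ≈-trans (∑-+ (subsets N) _ _) (+-congʳ (∑-+ (subsets N) _ _)) ⟩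
    (∑ (subsets N) (λ X → ind (eqB X (full N)) (term X S)) + ∑ (subsets N) (λ X → ind (eqB X (Vec.replicate N false)) (term X S)))
      + ∑ (subsets N) (λ X → ind (proper X) (term X S))
      ≈⟨ +-congʳ (+-cong (≈-trans (∑-subsets-eqB N (full N) _) full-term) (≈-trans (∑-subsets-eqB N _ _) empty-term)) ⟩
    (φ (subMC C S) emptyMC + φ emptyMC (subMC C S)) + ∑ (subsets N) (λ X → ind (proper X) (term X S)) ∎
    where
    full-term : term (full N) S ≈ φ (subMC C S) emptyMC
    full-term = φ-inv (restrict-subMC-full S) (≅-trans (restrict-cong (subMC C S) (compl-full N)) (restrict-subMC-empty S))
    empty-term : term (Vec.replicate N false) S ≈ φ emptyMC (subMC C S)
    empty-term = φ-inv (restrict-subMC-empty S) (≅-trans (restrict-cong (subMC C S) (compl-empty N)) (restrict-subMC-full S))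

  MaximalCrossing : Vec Bool N → Fin (m C) → Set
  MaximalCrossing X mx = (∀ j → le C mx j ≡ true → j ≡ mx) × isSingletonB C mx ≡ false ×
                         suppWithin X mx ≡ false × suppWithin (compl X) mx ≡ false

  proper⇒maximalCrossing : ∀ X → proper X ≡ true → ∃ (MaximalCrossing X)
  proper⇒maximalCrossing X X-proper =
    Crossing.maximal-crossing X (proj₁ inside) (proj₁ outside) (proj₂ (proj₂ inside)) (proj₁ (proj₂ outside)) connected
    where
    X≢full = BP.not-injective (∧-elimˡ X-proper)
    X≢empty = BP.not-injective (∧-elimʳ {not (eqB X (full N))} X-proper)
    outside = ⊊-witness X (full N) (λ i _ → lookup-full N i) X≢full
    inside = ⊊-witness (Vec.replicate N false) X (λ i h → ⊥-elim (true≢false-at h (VP.lookup-replicate i false)))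
               (BP.¬-not λ h → true≢false-at (eqB-complete X _ (sym (eqB-sound _ X h))) X≢empty)

  ∑-term-cancels : ∀ X mx → MaximalCrossing X mx → ∑ (XC C) (λ S → coeff S * term X S) ≈ 0#
  ∑-term-cancels X mx (mx-max , mx-nonsingleton , mx⊈X , mx⊈Xᶜ) = begin
    ∑ (XC C) (λ S → coeff S * term X S)                              ≈⟨ ∑-filter (subsets (m C)) (isSubB C) _ ⟩
    ∑ (subsets (m C)) (λ S → ind (isSubB C S) (coeff S * term X S))  ≈⟨ ∑-cong (subsets (m C)) closed-form ⟩
    ∑ (subsets (m C)) signed                                         ≈⟨ ∑-subsets-toggle-antisym (m C) mx signed signed-toggle ⟩
    0#                                                               ∎
    where
    open MaximalToggle mx mx-max mx-nonsingleton

    signed : V → Carrier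
    signed S = intR cring (μ-sub S) * term X S

    closed-form : ∀ S → ind (isSubB C S) (coeff S * term X S) ≈ signed S
    closed-form S with isSubB C S in S-sub
    ... | true  = *-congʳ (≈-reflexive (cong (intR cring) (μP-closed S (isSubB-sound S S-sub))))
    ... | false = ≈-sym (zeroˡ _)

    signed-toggle : ∀ S → lookup S mx ≡ false → signed (toggle mx S) ≈ - signed S
    signed-toggle S mx∉S = begin
      intR cring (μ-sub (toggle mx S)) * term X (toggle mx S)
        ≈⟨ *-cong (≈-reflexive (cong (intR cring) (μ-sub-toggle S mx∉S)))
                  (φ-inv (≅-sym (restrict-subMC-toggle X S mx mx⊈X)) (≅-sym (restrict-subMC-toggle (compl X) S mx mx⊈Xᶜ))) ⟩
      intR cring (ℤ.- μ-sub S) * term X S                     ≈⟨ *-congʳ (intR-neg cring (μ-sub S)) ⟩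
      (- intR cring (μ-sub S)) * term X S                     ≈⟨ ≈-sym (-‿distribˡ-* _ _) ⟩
      - signed S                                              ∎

  trivialPart : Carrier
  trivialPart = ∑ (XC C) (λ S → coeff S * φ (subMC C S) emptyMC) + ∑ (XC C) (λ S → coeff S * φ emptyMC (subMC C S))

  properPart : Carrier
  properPart = ∑ (XC C) (λ S → coeff S * ∑ (subsets N) (λ X → ind (proper X) (term X S)))

  eval-Δ-PC : eval (Δ (PC C)) ≈ trivialPart + properPart
  eval-Δ-PC = begin
    eval (Δ (PC C))                                                              ≈⟨ eval-Δ (PC C) ⟩
    ∑ (PC C) (λ (a , D) → intR cring a * ∑ (Δ₁ D) (λ (E , G) → φ E G))          ≈⟨ ∑-map (XC C) _ _ ⟩
    ∑ (XC C) (λ S → coeff S * ∑ (Δ₁ (subMC C S)) (λ (E , G) → φ E G))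
      ≈⟨ ∑-cong (XC C) (λ S → *-congˡ (≈-trans (∑-map (subsets N) _ _) (∑-term S))) ⟩
    ∑ (XC C) (λ S → coeff S * ((φ (subMC C S) emptyMC + φ emptyMC (subMC C S))
                               + ∑ (subsets N) (λ X → ind (proper X) (term X S))))
      ≈⟨ ∑-cong (XC C) (λ S → ≈-trans (distribˡ _ _ _) (+-congʳ (distribˡ _ _ _))) ⟩
    ∑ (XC C) (λ S → (coeff S * φ (subMC C S) emptyMC + coeff S * φ emptyMC (subMC C S))
                    + coeff S * ∑ (subsets N) (λ X → ind (proper X) (term X S)))
      ≈⟨ ≈-trans (∑-+ (XC C) _ _) (+-congʳ (∑-+ (XC C) _ _)) ⟩
    trivialPart + properPart                                                     ∎

  properPart≈0 : properPart ≈ 0#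
  properPart≈0 = begin
    properPart                                                                          ≈⟨ ∑-cong (XC C) (λ S → ≈-sym (∑-*ˡ (subsets N) (coeff S) _)) ⟩
    ∑ (XC C) (λ S → ∑ (subsets N) (λ X → coeff S * ind (proper X) (term X S)))          ≈⟨ ∑-comm (XC C) (subsets N) _ ⟩
    ∑ (subsets N) (λ X → ∑ (XC C) (λ S → coeff S * ind (proper X) (term X S)))          ≈⟨ ∑-zero (subsets N) _ vanishes ⟩
    0#                                                                                  ∎
    where
    vanishes : ∀ X → ∑ (XC C) (λ S → coeff S * ind (proper X) (term X S)) ≈ 0#
    vanishes X with proper X in X-proper
    ... | true  = ∑-term-cancels X _ (proj₂ (proper⇒maximalCrossing X X-proper))
    ... | false = ∑-zero (XC C) _ (λ S → zeroʳ _)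

  eval-PC⊗1+1⊗PC : eval ((PC C ⊗ unitH) ++ (unitH ⊗ PC C)) ≈ trivialPart
  eval-PC⊗1+1⊗PC = ≈-trans (eval-++ (PC C ⊗ unitH) (unitH ⊗ PC C))
    (+-cong (≈-trans (eval-⊗unit (PC C)) (∑-map (XC C) _ _)) (≈-trans (eval-unit⊗ (PC C)) (∑-map (XC C) _ _)))

proposition4p5 : {c ℓ : Level} (F : Char0Field c ℓ) (C : RawMC) →
    IsMC C → Connected C → 0 < n C →
    EqH⊗H F (Δ (PC C)) ((PC C ⊗ unitH) ++ (unitH ⊗ PC C))
proposition4p5 F C isMC connected pos φ φ-inv = begin
  eval (Δ (PC C))                             ≈⟨ eval-Δ-PC ⟩
  trivialPart + properPart                    ≈⟨ +-congˡ properPart≈0 ⟩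
  trivialPart + 0#                            ≈⟨ +-identityʳ trivialPart ⟩
  trivialPart                                 ≈⟨ ≈-sym eval-PC⊗1+1⊗PC ⟩
  eval ((PC C ⊗ unitH) ++ (unitH ⊗ PC C))     ∎
  where
  open Primitivity F C isMC connected pos φ φ-inv
  open Evaluation F φ using (eval)
  open CommutativeRing (Char0Field.cring F) using (_+_; 0#; +-congˡ; +-identityʳ)
    renaming (sym to ≈-sym; setoid to ≈-setoid)
  open import Relation.Binary.Reasoning.Setoid ≈-setoid
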